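{- Let $U$ be a non-empty finite set of positive integers, $p=(p_1,p_2)$ with $p_1,p_2$ positive integers and $p_1+p_2=|U|$, and $p'=(p_2,p_1)$. Then the map $F\mapsto F'$ is a bijection from $\mathcal{F}_{U,p}$ to $\mathcal{F}_{U,p'}$.
   Context: A tiered graph with two tiers is a simple graph $G$ whose vertex set is a finite set of positive integers, together with a map $t:V(G)\to\{1,2\}$ such that whenever $vv'\in E(G)$ with $v>v'$ we have $t(v)>t(v')$; write $V_i(G)=t^{ -1}(i)$. Tiered graphs are equal only if they have the same vertex set, edge set and sets $V_1,V_2$. $\mathcal{F}_{U,p}$ is the set of tiered graphs $F$ with two tiers that are forests, with $V(F)=U$ and $|V_i(F)|=p_i$ for $i=1,2$. Dual: for a connected tiered graph $C$ with $V(C)=\{x_1<\cdots<x_s\}$ and tiering map $t$, its dual $C'$ has $V(C')=V(C)$, tiering map $t'(x_r)=3-t(x_{s+1-r})$, and $x_ix_j\in E(C')$ iff $x_{s+1-i}x_{s+1-j}\in E(C)$ ($1\le i<j\le s$). For a general tiered graph $F$ with components $F_1,\dots,F_k$, $F'$ is the tiered graph with components $F_1',\dots,F_k'$ and tiering map inherited from these component duals. -}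

module Defs where

open import Data.Bool using (Bool; true; false; _∧_; _∨_; if_then_else_)
open import Data.Nat using (ℕ; zero; suc; _<_; _≤_; _∸_; _<ᵇ_; _≡ᵇ_)
open import Data.Fin using (Fin; toℕ; _≟_)
open import Data.List using (List; []; _∷_; length; filterᵇ; allFin; reverse; _∷ʳ_)
open import Data.Bool.ListAction using (any)
open import Data.List.Relation.Unary.All using (All)
open import Data.List.Relation.Unary.Unique.Propositional using (Unique)
open import Data.List.Relation.Unary.Linked using (Linked)
open import Data.Vec using (Vec; lookup; tabulate; toList)
open import Data.Product using (Σ; _×_)
open import Data.Sum using (_⊎_)
open import Relation.Nullary using (¬_; does)
open import Relation.Binary.PropositionalEquality using (_≡_)

-- Finite sets of positive integers are represented canonically as
-- strictly increasing lists of positive naturals.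

IsFinPosSet : List ℕ → Set
IsFinPosSet U = Linked _<_ U × All (λ u → 0 < u) U

-- A (two-tier) tiered-graph datum: vertex list (the vertex set, sorted
-- increasingly), tier vector (tier of the i-th vertex) and boolean
-- adjacency matrix indexed by positions in the vertex list.
-- All components are first-order data, so _≡_ on this record is exactly
-- equality of vertex set, edge set, V₁ and V₂.

record TieredGraph : Set where
  constructor mkTG
  field
    verts : List ℕ
    tier  : Vec ℕ (length verts)
    adj   : Vec (Vec Bool (length verts)) (length verts)

open TieredGraph public

N : TieredGraph → ℕ
N G = length (verts G)

vert : (G : TieredGraph) → Fin (N G) → ℕ
vert G i = Data.List.lookup (verts G) i

tierOf : (G : TieredGraph) → Fin (N G) → ℕ
tierOf G i = lookup (tier G) i

adjB : (G : TieredGraph) → Fin (N G) → Fin (N G) → Bool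
adjB G i j = lookup (lookup (adj G) i) j

Adj : (G : TieredGraph) → Fin (N G) → Fin (N G) → Set
Adj G i j = adjB G i j ≡ true

record IsTieredGraph (G : TieredGraph) : Set where
  field
    vertsSet : IsFinPosSet (verts G)
    tierVals : ∀ i → tierOf G i ≡ 1 ⊎ tierOf G i ≡ 2
    irrefl   : ∀ i → adjB G i i ≡ false
    symm     : ∀ i j → adjB G i j ≡ adjB G j i
    tiered   : ∀ i j → Adj G i j → vert G j < vert G i → tierOf G j < tierOf G i

-- A cycle: distinct vertices v, w₁, …, wₖ, w (k ≥ 1, so at least 3
-- vertices) with consecutive ones adjacent and w adjacent to v.
HasCycle : TieredGraph → Set
HasCycle G = Σ (Fin (N G)) λ v → Σ (List (Fin (N G))) λ ws → Σ (Fin (N G)) λ w →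
  (1 ≤ length ws) × Unique ((v ∷ ws) ∷ʳ w) × Linked (Adj G) ((v ∷ ws) ∷ʳ w) × Adj G w v

IsForest : TieredGraph → Set
IsForest G = ¬ HasCycle G

tierCount : (G : TieredGraph) → ℕ → ℕ
tierCount G k = length (filterᵇ (λ t → t ≡ᵇ k) (toList (tier G)))

InF : List ℕ → ℕ → ℕ → TieredGraph → Set
InF U p₁ p₂ F = IsTieredGraph F × verts F ≡ U × IsForest F
                × tierCount F 1 ≡ p₁ × tierCount F 2 ≡ p₂

module _ (G : TieredGraph) where

  private
    n = N G
    eqᵇ : Fin n → Fin n → Bool
    eqᵇ i j = does (i ≟ j)

  reachWithin : ℕ → Fin n → Fin n → Bool
  reachWithin zero    i j = eqᵇ i j
  reachWithin (suc k) i j =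
    reachWithin k i j ∨ any (λ m → reachWithin k i m ∧ adjB G m j) (allFin n)

  sameComp : Fin n → Fin n → Bool
  sameComp i j = reachWithin n i j

  -- vertices of the component of i, in increasing order x₁ < ⋯ < x_s
  -- (position order = numeric order, as the vertex list is increasing)
  component : Fin n → List (Fin n)
  component i = filterᵇ (sameComp i) (allFin n)

  -- r - 1 where i = x_r in its component
  rank : Fin n → ℕ
  rank i = length (filterᵇ (λ j → toℕ j <ᵇ toℕ i) (component i))

  nthOr : {A : Set} → A → List A → ℕ → A
  nthOr d []       _       = d
  nthOr d (x ∷ xs) zero    = x
  nthOr d (x ∷ xs) (suc k) = nthOr d xs k

  -- σ(x_r) = x_{s+1-r} within the component
  σ : Fin n → Fin n
  σ i = nthOr i (reverse (component i)) (rank i)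

dual : TieredGraph → TieredGraph
dual G = mkTG (verts G)
  (tabulate λ i → 3 ∸ tierOf G (σ G i))
  (tabulate λ i → tabulate λ j →
     if sameComp G i j then adjB G (σ G i) (σ G j) else false)

-- The heart of the proof is that duality is an involution, dual (dual G) ≡ G
-- for every tiered graph G; injectivity and surjectivity follow at once.
-- Write σ for the map x_r ↦ x_{s+1-r} inside each component (as in Defs).
--  * Components.  sameComp is defined as reachability within n steps.  The
--    sets reachable within k steps form an ascending chain of subsets of an
--    n-element set that stays constant once it stalls, so it is constant
--    from step n on; hence sameComp is the least reflexive relation closed
--    under adding an edge, and an equivalence when adjacency is symmetric.
--  * σ.  A component is a strictly sorted list and σ is its mirror map
--    (position r ↦ position s-1-r): an order-reversing involution.
--  * The dual D.  σ maps the edges of D onto the edges of G; so D has the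
--    same components as G and the same σ, which gives dual D ≡ G.  The same
--    fact shows that D is a tiered graph (σ reverses the vertex order while
--    t ↦ 3-t reverses the tier order), that a cycle of D is mapped by σ to a
--    cycle of G, and that tier k of D is the σ-image of tier 3-k of G.

module Submission where

open import Defs
open import Data.Bool using (Bool; true; false; T; _∨_; _∧_; if_then_else_)
open import Data.Bool.ListAction using (any; or)
open import Data.Bool.Properties using (∨-zeroʳ; T-≡; ⇔→≡)
open import Data.Fin using (Fin; zero; suc; toℕ; _≟_)
open import Data.Fin.Permutation using (Permutation; permutation; _⟨$⟩ʳ_)
open import Data.Fin.Properties using (toℕ-injective)
open import Data.Fin.Subset using (Subset; _∈_; _⊆_; _⊂_; ∣_∣)
open import Data.Fin.Subset.Properties using (_∈?_; _⊂?_; ⊆-antisym; ⊆-trans; ⊆-reflexive; p⊂q⇒∣p∣<∣q∣; ∣p∣≤n)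
open import Data.List using (List; []; _∷_; _∷ʳ_; [_]; length; map; reverse; filterᵇ; allFin)
import Data.List
open import Data.List.Membership.Propositional using () renaming (_∈_ to _∈ₗ_)
open import Data.List.Membership.Propositional.Properties using (∈-allFin; ∈-filter⁺; ∈-filter⁻; ∈-lookup)
open import Data.List.Properties using (map-cong; unfold-reverse; length-reverse; filter-accept; filter-reject; filter-≐; length-map; map-++)
open import Data.List.Relation.Unary.All as All using (All; []; _∷_)
open import Data.List.Relation.Unary.AllPairs using (AllPairs; _∷_)
open import Data.List.Relation.Unary.AllPairs.Properties using (tabulate⁺-<; filter⁺)
open import Data.List.Relation.Unary.Any using (here; there)
open import Data.List.Relation.Unary.Linked as Linked using (Linked)
import Data.List.Relation.Unary.Linked.Properties as Linked
open import Data.List.Relation.Unary.Unique.Propositional using (Unique)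
import Data.List.Relation.Unary.Unique.Propositional.Properties as Unique
open import Data.Nat using (ℕ; zero; suc; _+_; _∸_; _≤_; _<_; z≤n; s≤s; _<ᵇ_; _≡ᵇ_)
open import Data.Nat.Properties using (+-0-commutativeMonoid; ≤-refl; ≤-trans; <-trans; <-≤-trans; <⇒≤; <⇒≱; ≤⇒≯; <⇒≢; <-asym; <-cmp; +-comm; +-∸-assoc; n∸n≡0; m∸n≤m; m∸[m∸n]≡n; ∸-monoʳ-<; m<1+n⇒m<n∨m≡n; <ᵇ⇒<; <⇒<ᵇ)
open import Algebra.Properties.CommutativeMonoid.Sum +-0-commutativeMonoid using (sum; sum-cong-≗; sum-permute)
open import Data.Product using (Σ; ∃-syntax; _×_; _,_; proj₁; proj₂)
open import Data.Sum using (_⊎_; inj₁; inj₂)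
open import Data.Vec using (Vec; []; _∷_; lookup; tabulate; toList)
open import Data.Vec.Properties using (lookup∘tabulate; tabulate∘lookup; tabulate-cong; []=⇒lookup; lookup⇒[]=)
open import Function using (_∘_)
open import Function.Bundles using (Equivalence; mk⇔)
open import Relation.Binary using (tri<; tri≈; tri>)
open import Relation.Binary.PropositionalEquality using (_≡_; refl; sym; trans; cong; cong₂; subst; subst₂; _≗_; module ≡-Reasoning)
open import Relation.Nullary using (¬_; Dec; yes; no; does; contradiction)
open import Relation.Nullary.Decidable using (dec-true; T?)

open ≡-Reasoning

∨-introˡ : ∀ {a} b → a ≡ true → a ∨ b ≡ true
∨-introˡ b e = cong (_∨ b) e

∨-introʳ : ∀ a {b} → b ≡ true → a ∨ b ≡ true
∨-introʳ a e = trans (cong (a ∨_) e) (∨-zeroʳ a)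

∨-elim : ∀ a {b} → a ∨ b ≡ true → a ≡ true ⊎ b ≡ true
∨-elim true  _ = inj₁ refl
∨-elim false e = inj₂ e

∧-intro : ∀ {a b} → a ≡ true → b ≡ true → a ∧ b ≡ true
∧-intro refl refl = refl

∧-elim : ∀ a {b} → a ∧ b ≡ true → a ≡ true × b ≡ true
∧-elim true e = refl , e

does-sound : ∀ {A : Set} (a? : Dec A) → does a? ≡ true → A
does-sound (yes a) _ = a

module _ {A : Set} (p : A → Bool) where

  any-intro : ∀ {x xs} → x ∈ₗ xs → p x ≡ true → any p xs ≡ true
  any-intro {xs = y ∷ ys} (here refl) e = ∨-introˡ (any p ys) e
  any-intro {xs = y ∷ ys} (there x∈) e  = ∨-introʳ (p y) (any-intro x∈ e)

  any-elim : ∀ xs → any p xs ≡ true → ∃[ x ] p x ≡ true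
  any-elim (x ∷ xs) e with ∨-elim (p x) e
  ... | inj₁ px = x , px
  ... | inj₂ pxs = any-elim xs pxs

≡true-ext : ∀ {a b} → (a ≡ true → b ≡ true) → (b ≡ true → a ≡ true) → a ≡ b
≡true-ext a⇒b b⇒a = ⇔→≡ (mk⇔ a⇒b b⇒a)

filterᵇ-cong : ∀ {A : Set} {p q : A → Bool} → p ≗ q → ∀ xs → filterᵇ p xs ≡ filterᵇ q xs
filterᵇ-cong {p = p} {q} p≗q = filter-≐ (T? ∘ p) (T? ∘ q) ((λ {x} → subst T (p≗q x)) , (λ {x} → subst T (sym (p≗q x))))

if-cases : ∀ {A : Set} b {x y z : A} → (b ≡ true → x ≡ y) → (b ≡ false → y ≡ z) →
  (if b then x else z) ≡ y
if-cases true  x≡y _   = x≡y refl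
if-cases false _   y≡z = sym (y≡z refl)

if-false-true : ∀ b {x} → (if b then x else false) ≡ true → b ≡ true × x ≡ true
if-false-true true e = refl , e

∈-tabulate⁺ : ∀ {n} {P : Fin n → Bool} {x} → P x ≡ true → x ∈ tabulate P
∈-tabulate⁺ {P = P} {x} e = lookup⇒[]= x (tabulate P) (trans (lookup∘tabulate P x) e)

∈-tabulate⁻ : ∀ {n} {P : Fin n → Bool} {x} → x ∈ tabulate P → P x ≡ true
∈-tabulate⁻ {P = P} {x} x∈ = trans (sym (lookup∘tabulate P x)) ([]=⇒lookup x∈)

tabulate-injective : ∀ {n} {A : Set} {f g : Fin n → A} → tabulate f ≡ tabulate g → f ≗ g
tabulate-injective {f = f} {g} e x =
  trans (sym (lookup∘tabulate f x)) (trans (cong (λ v → lookup v x) e) (lookup∘tabulate g x))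

⊆∧⊄⇒≡ : ∀ {n} {p q : Subset n} → p ⊆ q → ¬ p ⊂ q → q ≡ p
⊆∧⊄⇒≡ {p = p} {q} p⊆q p⊄q = ⊆-antisym q⊆p p⊆q
  where
    q⊆p : q ⊆ p
    q⊆p {x} x∈q with x ∈? p
    ... | yes x∈p = x∈p
    ... | no  x∉p = contradiction ((λ {y} → p⊆q {y}) , x , x∈q , x∉p) p⊄q

-- An ascending chain S₀ ⊆ S₁ ⊆ ⋯ of subsets of an n-element set which,
-- once it stalls, stays constant, is bounded by its n-th member: every
-- strict step adds an element, and there is room for at most n of them.
module AscendingChain {n : ℕ} (S : ℕ → Subset n)
  (ascending  : ∀ k → S k ⊆ S (suc k))
  (persistent : ∀ k → S (suc k) ≡ S k → S (suc (suc k)) ≡ S (suc k)) where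

  stalls-or-grows : ∀ k → S (suc k) ≡ S k ⊎ ∣ S k ∣ < ∣ S (suc k) ∣
  stalls-or-grows k with S k ⊂? S (suc k)
  ... | yes S⊂S = inj₂ (p⊂q⇒∣p∣<∣q∣ S⊂S)
  ... | no  S⊄S = inj₁ (⊆∧⊄⇒≡ (ascending k) S⊄S)

  growth : ∀ k → S (suc k) ≡ S k ⊎ k < ∣ S (suc k) ∣
  growth zero with stalls-or-grows zero
  ... | inj₁ stall = inj₁ stall
  ... | inj₂ grow  = inj₂ (<-≤-trans (s≤s z≤n) grow)
  growth (suc k) with growth k
  ... | inj₁ stall = inj₁ (persistent k stall)
  ... | inj₂ big with stalls-or-grows (suc k)
  ...   | inj₁ stall = inj₁ stall
  ...   | inj₂ grow  = inj₂ (≤-trans (s≤s big) grow)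

  -- A chain that could still grow at step n would have more than n elements.
  stalled : ∀ d → S (suc (d + n)) ≡ S (d + n)
  stalled zero with growth n
  ... | inj₁ stall = stall
  ... | inj₂ big   = contradiction (∣p∣≤n (S (suc n))) (<⇒≱ big)
  stalled (suc d) = persistent (d + n) (stalled d)

  settled : ∀ d → S (d + n) ≡ S n
  settled zero    = refl
  settled (suc d) = trans (stalled d) (settled d)

  ascending⁺ : ∀ d k → S k ⊆ S (d + k)
  ascending⁺ zero    k = λ x∈ → x∈
  ascending⁺ (suc d) k = λ x∈ → ascending (d + k) (ascending⁺ d k x∈)

  bounded : ∀ k → S k ⊆ S n
  bounded k = ⊆-trans (ascending⁺ n k)
    (⊆-reflexive (trans (cong S (+-comm n k)) (settled k)))

module Reachability (G : TieredGraph) where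

  private
    V = Fin (N G)

  reach-mono : ∀ k {i j} → reachWithin G k i j ≡ true → reachWithin G (suc k) i j ≡ true
  reach-mono k r = ∨-introˡ _ r

  reach-step : ∀ k {i m j} → reachWithin G k i m ≡ true → Adj G m j →
    reachWithin G (suc k) i j ≡ true
  reach-step k {i} {m} {j} r a = ∨-introʳ (reachWithin G k i j)
    (any-intro (λ m → reachWithin G k i m ∧ adjB G m j) (∈-allFin m) (∧-intro r a))

  reach-ind : (R : V → V → Set) → (∀ i → R i i) → (∀ {i m j} → R i m → Adj G m j → R i j) →
    ∀ k {i j} → reachWithin G k i j ≡ true → R i j
  reach-ind R R-refl R-step zero {i} {j} r with does-sound (i ≟ j) r
  ... | refl = R-refl i
  reach-ind R R-refl R-step (suc k) {i} {j} r with ∨-elim (reachWithin G k i j) r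
  ... | inj₁ r′ = reach-ind R R-refl R-step k r′
  ... | inj₂ r′ with any-elim (λ m → reachWithin G k i m ∧ adjB G m j) (allFin (N G)) r′
  ...   | m , r∧a with ∧-elim (reachWithin G k i m) r∧a
  ...     | rm , a = R-step (reach-ind R R-refl R-step k rm) a

  reachSet : V → ℕ → Subset (N G)
  reachSet i k = tabulate (reachWithin G k i)

  -- reachWithin (k + 1) i depends only on the values of reachWithin k i.
  reachSet-ascending : ∀ i k → reachSet i k ⊆ reachSet i (suc k)
  reachSet-ascending i k x∈ = ∈-tabulate⁺ (reach-mono k (∈-tabulate⁻ x∈))

  reachSet-persistent : ∀ i k → reachSet i (suc k) ≡ reachSet i k →
    reachSet i (suc (suc k)) ≡ reachSet i (suc k)
  reachSet-persistent i k e = tabulate-cong λ j →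
    cong₂ _∨_ (stall j) (cong or (map-cong (λ m → cong (_∧ adjB G m j) (stall m)) (allFin (N G))))
    where
      stall : reachWithin G (suc k) i ≗ reachWithin G k i
      stall = tabulate-injective e

  reach⇒sameComp : ∀ k {i j} → reachWithin G k i j ≡ true → sameComp G i j ≡ true
  reach⇒sameComp k {i} r = ∈-tabulate⁻
    (AscendingChain.bounded (reachSet i) (reachSet-ascending i) (reachSet-persistent i) k (∈-tabulate⁺ r))

  sameComp-refl : ∀ i → sameComp G i i ≡ true
  sameComp-refl i = reach⇒sameComp 0 (dec-true (i ≟ i) refl)

  sameComp-step : ∀ {i m j} → sameComp G i m ≡ true → Adj G m j → sameComp G i j ≡ true
  sameComp-step r a = reach⇒sameComp (suc (N G)) (reach-step (N G) r a)

  sameComp-ind : (R : V → V → Set) → (∀ i → R i i) → (∀ {i m j} → R i m → Adj G m j → R i j) →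
    ∀ {i j} → sameComp G i j ≡ true → R i j
  sameComp-ind R R-refl R-step = reach-ind R R-refl R-step (N G)

  sameComp-adj : ∀ {i j} → Adj G i j → sameComp G i j ≡ true
  sameComp-adj {i} a = sameComp-step (sameComp-refl i) a

  adj-outside : ∀ {i j} → sameComp G i j ≡ false → adjB G i j ≡ false
  adj-outside {i} {j} ij with adjB G i j in a
  ... | false = refl
  ... | true  = contradiction (trans (sym ij) (sameComp-adj a)) λ ()

  sameComp-trans : ∀ {i m j} → sameComp G i m ≡ true → sameComp G m j ≡ true → sameComp G i j ≡ true
  sameComp-trans {i} im mj =
    sameComp-ind (λ m j → sameComp G i m ≡ true → sameComp G i j ≡ true)
      (λ _ h → h) (λ h a im → sameComp-step (h im) a) mj im

  module _ (symm : ∀ i j → adjB G i j ≡ adjB G j i) where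

    sameComp-sym : ∀ {i j} → sameComp G i j ≡ true → sameComp G j i ≡ true
    sameComp-sym = sameComp-ind (λ i j → sameComp G j i ≡ true) sameComp-refl
      (λ {i} {m} {j} mi a → sameComp-trans (sameComp-adj (trans (symm j m) a)) mi)

    sameComp-comm : ∀ i j → sameComp G i j ≡ sameComp G j i
    sameComp-comm i j = ≡true-ext sameComp-sym sameComp-sym

-- Indexing into a list with a default value; nthOr from the definition
-- of the dual does not depend on its graph parameter.
nth : {A : Set} → A → List A → ℕ → A
nth d []       _       = d
nth d (x ∷ xs) zero    = x
nth d (x ∷ xs) (suc r) = nth d xs r

nthOr≡nth : ∀ G {A : Set} (d : A) xs r → nthOr G d xs r ≡ nth d xs r
nthOr≡nth G d []       r       = refl
nthOr≡nth G d (x ∷ xs) zero    = refl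
nthOr≡nth G d (x ∷ xs) (suc r) = nthOr≡nth G d xs r

module _ {A : Set} where

  nth-∈ : ∀ d {xs : List A} {r} → r < length xs → nth d xs r ∈ₗ xs
  nth-∈ d {x ∷ xs} {zero}  _       = here refl
  nth-∈ d {x ∷ xs} {suc r} (s≤s h) = there (nth-∈ d h)

  nth-default : ∀ d d′ (xs : List A) {r} → r < length xs → nth d xs r ≡ nth d′ xs r
  nth-default d d′ (x ∷ xs) {zero}  _       = refl
  nth-default d d′ (x ∷ xs) {suc r} (s≤s h) = nth-default d d′ xs h

  nth-∷ʳ-< : ∀ d (xs : List A) x {r} → r < length xs → nth d (xs ∷ʳ x) r ≡ nth d xs r
  nth-∷ʳ-< d (y ∷ ys) x {zero}  _       = refl
  nth-∷ʳ-< d (y ∷ ys) x {suc r} (s≤s h) = nth-∷ʳ-< d ys x h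

  nth-∷ʳ-last : ∀ d (xs : List A) x → nth d (xs ∷ʳ x) (length xs) ≡ x
  nth-∷ʳ-last d []       x = refl
  nth-∷ʳ-last d (y ∷ ys) x = nth-∷ʳ-last d ys x

  nth-reverse : ∀ d (xs : List A) {r} → r < length xs →
    nth d (reverse xs) r ≡ nth d xs (length xs ∸ suc r)
  nth-reverse d (x ∷ xs) {r} h rewrite unfold-reverse x xs with m<1+n⇒m<n∨m≡n h
  ... | inj₁ r<s = begin
    nth d (reverse xs ∷ʳ x) r                ≡⟨ nth-∷ʳ-< d (reverse xs) x (subst (r <_) (sym (length-reverse xs)) r<s) ⟩
    nth d (reverse xs) r                     ≡⟨ nth-reverse d xs r<s ⟩
    nth d xs (length xs ∸ suc r)             ≡⟨ cong (nth d (x ∷ xs)) (sym (+-∸-assoc 1 r<s)) ⟩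
    nth d (x ∷ xs) (suc (length xs) ∸ suc r) ∎
  ... | inj₂ refl = begin
    nth d (reverse xs ∷ʳ x) (length xs)      ≡⟨ cong (nth d (reverse xs ∷ʳ x)) (sym (length-reverse xs)) ⟩
    nth d (reverse xs ∷ʳ x) (length (reverse xs)) ≡⟨ nth-∷ʳ-last d (reverse xs) x ⟩
    x                                        ≡⟨ cong (nth d (x ∷ xs)) (sym (n∸n≡0 (length xs))) ⟩
    nth d (x ∷ xs) (length xs ∸ length xs)   ∎

∸-suc-< : ∀ {r s} → r < s → s ∸ suc r < s
∸-suc-< {r} {suc s} _ = s≤s (m∸n≤m s r)

∸-suc-involutive : ∀ {r s} → r < s → s ∸ suc (s ∸ suc r) ≡ r
∸-suc-involutive {r} {suc s} (s≤s r≤s) = m∸[m∸n]≡n r≤s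

module Sorted {n : ℕ} where

  _≺_ : Fin n → Fin n → Set
  a ≺ b = toℕ a < toℕ b

  IsSorted : List (Fin n) → Set
  IsSorted = AllPairs _≺_

  -- The number of entries of xs below x; the position of x when x ∈ xs.
  below : Fin n → List (Fin n) → ℕ
  below x xs = length (filterᵇ (λ j → toℕ j <ᵇ toℕ x) xs)

  below-∷-≺ : ∀ {x y} ys → y ≺ x → below x (y ∷ ys) ≡ suc (below x ys)
  below-∷-≺ {x} ys y≺x = cong length (filter-accept (λ j → T? (toℕ j <ᵇ toℕ x)) (<⇒<ᵇ y≺x))

  below-∷-⊀ : ∀ {x y} ys → ¬ y ≺ x → below x (y ∷ ys) ≡ below x ys
  below-∷-⊀ {x} ys y⊀x = cong length (filter-reject (λ j → T? (toℕ j <ᵇ toℕ x)) (y⊀x ∘ <ᵇ⇒< _ _))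

  below-least : ∀ {x} ys → All (λ y → toℕ x ≤ toℕ y) ys → below x ys ≡ 0
  below-least []       []          = refl
  below-least (y ∷ ys) (x≤y ∷ x≤ys) = trans (below-∷-⊀ ys (≤⇒≯ x≤y)) (below-least ys x≤ys)

  below-head : ∀ {y ys} → IsSorted (y ∷ ys) → below y (y ∷ ys) ≡ 0
  below-head {y} {ys} (y≺ys ∷ _) = below-least (y ∷ ys) (≤-refl ∷ All.map <⇒≤ y≺ys)

  below<length : ∀ {x c} → IsSorted c → x ∈ₗ c → below x c < length c
  below<length {c = y ∷ ys} s (here refl) rewrite below-head s = s≤s z≤n
  below<length {c = y ∷ ys} (y≺ys ∷ s) (there x∈) rewrite below-∷-≺ ys (All.lookup y≺ys x∈) =
    s≤s (below<length s x∈)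

  nth-below : ∀ d {x c} → IsSorted c → x ∈ₗ c → nth d c (below x c) ≡ x
  nth-below d {c = y ∷ ys} s (here refl) rewrite below-head s = refl
  nth-below d {c = y ∷ ys} (y≺ys ∷ s) (there x∈) rewrite below-∷-≺ ys (All.lookup y≺ys x∈) =
    nth-below d s x∈

  below-nth : ∀ d {c r} → IsSorted c → r < length c → below (nth d c r) c ≡ r
  below-nth d {y ∷ ys} {zero}  s _ = below-head s
  below-nth d {y ∷ ys} {suc r} (y≺ys ∷ s) (s≤s r<s)
    rewrite below-∷-≺ ys (All.lookup y≺ys (nth-∈ d r<s)) = cong suc (below-nth d s r<s)

  nth-≺ : ∀ d d′ {c r r′} → IsSorted c → r < r′ → r′ < length c → nth d c r ≺ nth d′ c r′
  nth-≺ d d′ {y ∷ ys} {zero}  {suc r′} (y≺ys ∷ _) _ (s≤s r′<s) = All.lookup y≺ys (nth-∈ d′ r′<s)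
  nth-≺ d d′ {y ∷ ys} {suc r} {suc r′} (_ ∷ s) (s≤s r<r′) (s≤s r′<s) = nth-≺ d d′ s r<r′ r′<s

  below-≺ : ∀ {c x y} → IsSorted c → x ∈ₗ c → y ∈ₗ c → y ≺ x → below y c < below x c
  below-≺ {c} {x} {y} s x∈ y∈ y≺x with <-cmp (below y c) (below x c)
  ... | tri< lt _ _ = lt
  ... | tri≈ _ eq _ = contradiction (cong toℕ y≡x) (<⇒≢ y≺x)
    where
      y≡x : y ≡ x
      y≡x = begin
        y                    ≡⟨ sym (nth-below y s y∈) ⟩
        nth y c (below y c)  ≡⟨ cong (nth y c) eq ⟩
        nth y c (below x c)  ≡⟨ nth-default y x c (below<length s x∈) ⟩
        nth x c (below x c)  ≡⟨ nth-below x s x∈ ⟩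
        x                    ∎
  ... | tri> _ _ gt = contradiction y≺x (<-asym
        (subst₂ _≺_ (nth-below x s x∈) (nth-below y s y∈) (nth-≺ x y s gt (below<length s y∈))))

  mirror : List (Fin n) → Fin n → Fin n
  mirror c x = nth x c (length c ∸ suc (below x c))

  module _ {c : List (Fin n)} (s : IsSorted c) where

    mirror-∈ : ∀ {x} → x ∈ₗ c → mirror c x ∈ₗ c
    mirror-∈ x∈ = nth-∈ _ (∸-suc-< (below<length s x∈))

    mirror-involutive : ∀ {x} → x ∈ₗ c → mirror c (mirror c x) ≡ x
    mirror-involutive {x} x∈ = begin
      nth x′ c (length c ∸ suc (below x′ c))  ≡⟨ cong (λ r → nth x′ c (length c ∸ suc r)) (below-nth x s (∸-suc-< b<s)) ⟩
      nth x′ c (length c ∸ suc (length c ∸ suc (below x c)))  ≡⟨ cong (nth x′ c) (∸-suc-involutive b<s) ⟩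
      nth x′ c (below x c)                    ≡⟨ nth-default x′ x c b<s ⟩
      nth x c (below x c)                     ≡⟨ nth-below x s x∈ ⟩
      x                                       ∎
      where
        x′ = mirror c x
        b<s = below<length s x∈

    mirror-reverses : ∀ {x y} → x ∈ₗ c → y ∈ₗ c → y ≺ x → mirror c x ≺ mirror c y
    mirror-reverses {x} {y} x∈ y∈ y≺x = nth-≺ x y s
      (∸-monoʳ-< (s≤s (below-≺ s x∈ y∈ y≺x)) (below<length s x∈))
      (∸-suc-< (below<length s y∈))

module Components (G : TieredGraph) where

  open Reachability G
  open Sorted

  component-sorted : ∀ i → IsSorted (component G i)
  component-sorted i = filter⁺ (T? ∘ sameComp G i) (tabulate⁺-< (λ i<j → i<j))

  ∈-component⁺ : ∀ {i j} → sameComp G i j ≡ true → j ∈ₗ component G i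
  ∈-component⁺ {i} {j} ij = ∈-filter⁺ (T? ∘ sameComp G i) (∈-allFin j) (Equivalence.from T-≡ ij)

  ∈-component⁻ : ∀ {i j} → j ∈ₗ component G i → sameComp G i j ≡ true
  ∈-component⁻ {i} j∈ = Equivalence.to T-≡ (proj₂ (∈-filter⁻ (T? ∘ sameComp G i) {xs = allFin (N G)} j∈))

  σ≡mirror : ∀ i → σ G i ≡ mirror (component G i) i
  σ≡mirror i = begin
    nthOr G i (reverse c) (below i c)  ≡⟨ nthOr≡nth G i (reverse c) (below i c) ⟩
    nth i (reverse c) (below i c)      ≡⟨ nth-reverse i c (below<length (component-sorted i) (∈-component⁺ (sameComp-refl i))) ⟩
    mirror c i                         ∎
    where
      c = component G i

  -- With symmetric adjacency sameComp is an equivalence, so all vertices of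
  -- a component share the same list, and σ is an order-reversing involution
  -- of each component.
  module _ (symm : ∀ i j → adjB G i j ≡ adjB G j i) where

    component-cong : ∀ {i j} → sameComp G i j ≡ true → component G j ≡ component G i
    component-cong ij = filterᵇ-cong
      (λ x → ≡true-ext (sameComp-trans ij) (sameComp-trans (sameComp-sym symm ij))) (allFin (N G))

    σ-sameComp : ∀ i → sameComp G i (σ G i) ≡ true
    σ-sameComp i = ∈-component⁻ (subst (_∈ₗ component G i) (sym (σ≡mirror i))
      (mirror-∈ (component-sorted i) (∈-component⁺ (sameComp-refl i))))

    σ≡mirror-of : ∀ {i j} → sameComp G i j ≡ true → σ G j ≡ mirror (component G i) j
    σ≡mirror-of {i} {j} ij = trans (σ≡mirror j) (cong (λ c → mirror c j) (component-cong ij))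

    σ-involutive : ∀ i → σ G (σ G i) ≡ i
    σ-involutive i = begin
      σ G (σ G i)      ≡⟨ σ≡mirror-of (σ-sameComp i) ⟩
      mirror c (σ G i) ≡⟨ cong (mirror c) (σ≡mirror i) ⟩
      mirror c (mirror c i) ≡⟨ mirror-involutive (component-sorted i) (∈-component⁺ (sameComp-refl i)) ⟩
      i                ∎
      where
        c = component G i

    σ-preserves-sameComp : ∀ {i j} → sameComp G i j ≡ true → sameComp G (σ G i) (σ G j) ≡ true
    σ-preserves-sameComp {i} {j} ij = sameComp-trans (sameComp-sym symm (σ-sameComp i))
      (sameComp-trans ij (σ-sameComp j))

    σ-injective : ∀ {i j} → σ G i ≡ σ G j → i ≡ j
    σ-injective {i} {j} e = trans (sym (σ-involutive i)) (trans (cong (σ G) e) (σ-involutive j))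

    σ-reverses : ∀ {i j} → sameComp G i j ≡ true → toℕ j < toℕ i → toℕ (σ G i) < toℕ (σ G j)
    σ-reverses {i} {j} ij j<i = subst₂ _≺_ (sym (σ≡mirror i)) (sym (σ≡mirror-of ij))
      (mirror-reverses (component-sorted i) (∈-component⁺ (sameComp-refl i)) (∈-component⁺ ij) j<i)

count : ∀ {n} → (Fin n → Bool) → ℕ
count p = sum (λ i → if p i then 1 else 0)

count-cong : ∀ {n} {p q : Fin n → Bool} → p ≗ q → count p ≡ count q
count-cong p≗q = sum-cong-≗ (λ i → cong (λ b → if b then 1 else 0) (p≗q i))

count-permute : ∀ {n} (p : Fin n → Bool) (π : Permutation n n) → count (p ∘ (π ⟨$⟩ʳ_)) ≡ count p
count-permute p π = sym (sum-permute (λ i → if p i then 1 else 0) π)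

length-filterᵇ-toList : ∀ {A : Set} {m} (p : A → Bool) (v : Vec A m) →
  length (filterᵇ p (toList v)) ≡ count (p ∘ lookup v)
length-filterᵇ-toList p []       = refl
length-filterᵇ-toList p (x ∷ xs) with p x
... | true  = cong suc (length-filterᵇ-toList p xs)
... | false = length-filterᵇ-toList p xs

lookup-strictMono : ∀ {xs : List ℕ} → AllPairs _<_ xs → ∀ {i j : Fin (length xs)} →
  toℕ i < toℕ j → Data.List.lookup xs i < Data.List.lookup xs j
lookup-strictMono {x ∷ xs} (x<xs ∷ _)  {zero}  {suc j} _         = All.lookup x<xs (∈-lookup j)
lookup-strictMono {x ∷ xs} (_ ∷ sorted) {suc i} {suc j} (s≤s i<j) = lookup-strictMono sorted i<j

lookup-reflects-< : ∀ {xs : List ℕ} → AllPairs _<_ xs → ∀ {i j : Fin (length xs)} →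
  Data.List.lookup xs j < Data.List.lookup xs i → toℕ j < toℕ i
lookup-reflects-< {xs} sorted {i} {j} xⱼ<xᵢ with <-cmp (toℕ j) (toℕ i)
... | tri< j<i _ _ = j<i
... | tri≈ _ j≡i _ = contradiction (cong (Data.List.lookup xs) (toℕ-injective j≡i)) (<⇒≢ xⱼ<xᵢ)
... | tri> _ _ i<j = contradiction (lookup-strictMono {xs} sorted i<j) (<-asym xⱼ<xᵢ)

3∸-tier : ∀ {t} → t ≡ 1 ⊎ t ≡ 2 → 3 ∸ t ≡ 1 ⊎ 3 ∸ t ≡ 2
3∸-tier (inj₁ refl) = inj₂ refl
3∸-tier (inj₂ refl) = inj₁ refl

tier≤3 : ∀ {t} → t ≡ 1 ⊎ t ≡ 2 → t ≤ 3
tier≤3 (inj₁ refl) = s≤s z≤n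
tier≤3 (inj₂ refl) = s≤s (s≤s z≤n)

3∸-≡ᵇ : ∀ {t k} → t ≡ 1 ⊎ t ≡ 2 → k ≡ 1 ⊎ k ≡ 2 → (3 ∸ t ≡ᵇ k) ≡ (t ≡ᵇ 3 ∸ k)
3∸-≡ᵇ (inj₁ refl) (inj₁ refl) = refl
3∸-≡ᵇ (inj₁ refl) (inj₂ refl) = refl
3∸-≡ᵇ (inj₂ refl) (inj₁ refl) = refl
3∸-≡ᵇ (inj₂ refl) (inj₂ refl) = refl

module Dual (G : TieredGraph) (G-tiered : IsTieredGraph G) where

  open IsTieredGraph G-tiered
  open Reachability
  open Components

  private
    D = dual G
    σG = σ G

  tierOf-dual : ∀ i → tierOf D i ≡ 3 ∸ tierOf G (σG i)
  tierOf-dual i = lookup∘tabulate _ i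

  adjB-dual : ∀ i j → adjB D i j ≡ (if sameComp G i j then adjB G (σG i) (σG j) else false)
  adjB-dual i j = trans (cong (λ row → lookup row j) (lookup∘tabulate _ i)) (lookup∘tabulate _ j)

  adj-dual⁻ : ∀ {i j} → Adj D i j → sameComp G i j ≡ true × Adj G (σG i) (σG j)
  adj-dual⁻ {i} {j} a = if-false-true (sameComp G i j) (trans (sym (adjB-dual i j)) a)

  adjB-dual-σ : ∀ {i j} → sameComp G i j ≡ true → adjB D (σG i) (σG j) ≡ adjB G i j
  adjB-dual-σ {i} {j} ij = begin
    adjB D (σG i) (σG j)
      ≡⟨ adjB-dual (σG i) (σG j) ⟩
    (if sameComp G (σG i) (σG j) then adjB G (σG (σG i)) (σG (σG j)) else false)
      ≡⟨ cong (λ b → if b then adjB G (σG (σG i)) (σG (σG j)) else false) (σ-preserves-sameComp G symm ij) ⟩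
    adjB G (σG (σG i)) (σG (σG j))
      ≡⟨ cong₂ (adjB G) (σ-involutive G symm i) (σ-involutive G symm j) ⟩
    adjB G i j ∎

  adj-dual⁺ : ∀ {i j} → Adj G i j → Adj D (σG i) (σG j)
  adj-dual⁺ a = trans (adjB-dual-σ (sameComp-adj G a)) a

  -- D and G have the same components: edges of D stay within components of G,
  -- and σ carries G-walks to D-walks.
  sameComp-dual : ∀ i j → sameComp D i j ≡ sameComp G i j
  sameComp-dual i j = ≡true-ext
    (sameComp-ind D (λ i j → sameComp G i j ≡ true) (sameComp-refl G)
      (λ im a → sameComp-trans G im (proj₁ (adj-dual⁻ a))))
    (λ ij → subst₂ (λ x y → sameComp D x y ≡ true) (σ-involutive G symm i) (σ-involutive G symm j)
      (sameComp-ind G (λ a b → sameComp D (σG a) (σG b) ≡ true) (λ a → sameComp-refl D (σG a))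
        (λ am a → sameComp-step D am (adj-dual⁺ a)) (σ-preserves-sameComp G symm ij)))

  σ-dual : ∀ i → σ D i ≡ σG i
  σ-dual i = begin
    σ D i                       ≡⟨ σ≡mirror D i ⟩
    Sorted.mirror (component D i) i ≡⟨ cong (λ c → Sorted.mirror c i) (filterᵇ-cong (sameComp-dual i) (allFin (N G))) ⟩
    Sorted.mirror (component G i) i ≡⟨ sym (σ≡mirror G i) ⟩
    σG i                        ∎

  dual-involutive : dual D ≡ G
  dual-involutive = cong₂ (mkTG (verts G))
    (trans (tabulate-cong tier-involutive) (tabulate∘lookup (tier G)))
    (trans (tabulate-cong (λ i → trans (tabulate-cong (adj-involutive i)) (tabulate∘lookup _)))
           (tabulate∘lookup (adj G)))
    where
      tier-involutive : ∀ i → 3 ∸ tierOf D (σ D i) ≡ tierOf G i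
      tier-involutive i = begin
        3 ∸ tierOf D (σ D i)            ≡⟨ cong (λ k → 3 ∸ tierOf D k) (σ-dual i) ⟩
        3 ∸ tierOf D (σG i)             ≡⟨ cong (3 ∸_) (tierOf-dual (σG i)) ⟩
        3 ∸ (3 ∸ tierOf G (σG (σG i)))  ≡⟨ cong (λ k → 3 ∸ (3 ∸ tierOf G k)) (σ-involutive G symm i) ⟩
        3 ∸ (3 ∸ tierOf G i)            ≡⟨ m∸[m∸n]≡n (tier≤3 (tierVals i)) ⟩
        tierOf G i                      ∎

      adj-involutive : ∀ i j → (if sameComp D i j then adjB D (σ D i) (σ D j) else false) ≡ adjB G i j
      adj-involutive i j = begin
        (if sameComp D i j then adjB D (σ D i) (σ D j) else false)
          ≡⟨ cong₂ (λ b x → if b then x else false) (sameComp-dual i j) (cong₂ (adjB D) (σ-dual i) (σ-dual j)) ⟩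
        (if sameComp G i j then adjB D (σG i) (σG j) else false)
          ≡⟨ if-cases (sameComp G i j) adjB-dual-σ (adj-outside G) ⟩
        adjB G i j ∎

  -- An edge of D going down from i to j is, through σ, an edge of G going
  -- down from σj to σi, which raises the tier; t ↦ 3 - t turns this around.
  dual-tiered : ∀ i j → Adj D i j → vert D j < vert D i → tierOf D j < tierOf D i
  dual-tiered i j a vⱼ<vᵢ = subst₂ _<_ (sym (tierOf-dual j)) (sym (tierOf-dual i))
    (∸-monoʳ-< tσi<tσj (tier≤3 (tierVals (σG j))))
    where
      verts-sorted : AllPairs _<_ (verts G)
      verts-sorted = Linked.Linked⇒AllPairs <-trans (proj₁ vertsSet)
      σi<σj : toℕ (σG i) < toℕ (σG j)
      σi<σj = σ-reverses G symm (proj₁ (adj-dual⁻ a)) (lookup-reflects-< verts-sorted vⱼ<vᵢ)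
      tσi<tσj : tierOf G (σG i) < tierOf G (σG j)
      tσi<tσj = tiered (σG j) (σG i) (trans (symm (σG j) (σG i)) (proj₂ (adj-dual⁻ a)))
        (lookup-strictMono verts-sorted σi<σj)

  dual-isTieredGraph : IsTieredGraph D
  dual-isTieredGraph = record
    { vertsSet = vertsSet
    ; tierVals = λ i → subst (λ t → t ≡ 1 ⊎ t ≡ 2) (sym (tierOf-dual i)) (3∸-tier (tierVals (σG i)))
    ; irrefl   = λ i → begin
        adjB D i i                                                    ≡⟨ adjB-dual i i ⟩
        (if sameComp G i i then adjB G (σG i) (σG i) else false)      ≡⟨ cong (λ b → if b then adjB G (σG i) (σG i) else false) (sameComp-refl G i) ⟩
        adjB G (σG i) (σG i)                                          ≡⟨ irrefl (σG i) ⟩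
        false                                                         ∎
    ; symm     = λ i j → begin
        adjB D i j                                                    ≡⟨ adjB-dual i j ⟩
        (if sameComp G i j then adjB G (σG i) (σG j) else false)      ≡⟨ cong₂ (λ b x → if b then x else false) (sameComp-comm G symm i j) (symm (σG i) (σG j)) ⟩
        (if sameComp G j i then adjB G (σG j) (σG i) else false)      ≡⟨ sym (adjB-dual j i) ⟩
        adjB D j i                                                    ∎
    ; tiered   = dual-tiered
    }

  dual-forest : IsForest G → IsForest D
  dual-forest acyclic (v , ws , w , 1≤len , unique , linked , wv) = acyclic
    ( σG v , map σG ws , σG w
    , subst (1 ≤_) (sym (length-map σG ws)) 1≤len
    , subst Unique (map-++ σG (v ∷ ws) [ w ]) (Unique.map⁺ (σ-injective G symm) unique)
    , subst (Linked (Adj G)) (map-++ σG (v ∷ ws) [ w ])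
        (Linked.map⁺ (Linked.map (λ a → proj₂ (adj-dual⁻ a)) linked))
    , proj₂ (adj-dual⁻ wv) )

  tierCount-dual : ∀ k → k ≡ 1 ⊎ k ≡ 2 → tierCount D k ≡ tierCount G (3 ∸ k)
  tierCount-dual k tier-k = begin
    tierCount D k                          ≡⟨ length-filterᵇ-toList (_≡ᵇ k) (tier D) ⟩
    count (λ i → tierOf D i ≡ᵇ k)          ≡⟨ count-cong (λ i → trans (cong (_≡ᵇ k) (tierOf-dual i)) (3∸-≡ᵇ (tierVals (σG i)) tier-k)) ⟩
    count (λ i → tierOf G (σG i) ≡ᵇ 3 ∸ k) ≡⟨ count-permute (λ i → tierOf G i ≡ᵇ 3 ∸ k) σ-permutation ⟩
    count (λ i → tierOf G i ≡ᵇ 3 ∸ k)      ≡⟨ sym (length-filterᵇ-toList (_≡ᵇ 3 ∸ k) (tier G)) ⟩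
    tierCount G (3 ∸ k)                    ∎
    where
      σ-permutation : Permutation (N G) (N G)
      σ-permutation = permutation σG σG (σ-involutive G symm) (σ-involutive G symm)

dual-InF : ∀ U p₁ p₂ F → InF U p₁ p₂ F → InF U p₂ p₁ (dual F)
dual-InF U p₁ p₂ F (F-tiered , verts≡U , acyclic , count₁ , count₂) =
  dual-isTieredGraph , verts≡U , dual-forest acyclic ,
  trans (tierCount-dual 1 (inj₁ refl)) count₂ , trans (tierCount-dual 2 (inj₂ refl)) count₁
  where open Dual F F-tiered

proposition2p1 : (U : List ℕ) → IsFinPosSet U → 1 ≤ length U →
    (p₁ p₂ : ℕ) → 1 ≤ p₁ → 1 ≤ p₂ → p₁ + p₂ ≡ length U →
    ((F : TieredGraph) → InF U p₁ p₂ F → InF U p₂ p₁ (dual F))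
    × ((F G : TieredGraph) → InF U p₁ p₂ F → InF U p₁ p₂ G → dual F ≡ dual G → F ≡ G)
    × ((G : TieredGraph) → InF U p₂ p₁ G → Σ TieredGraph λ F → InF U p₁ p₂ F × dual F ≡ G)
proposition2p1 U _ _ p₁ p₂ _ _ _ = dual-InF U p₁ p₂ , injective , surjective
  where
    involutive : ∀ {p q} F → InF U p q F → dual (dual F) ≡ F
    involutive F F∈ = Dual.dual-involutive F (proj₁ F∈)

    injective : ∀ F G → InF U p₁ p₂ F → InF U p₁ p₂ G → dual F ≡ dual G → F ≡ G
    injective F G F∈ G∈ e = begin
      F               ≡⟨ sym (involutive F F∈) ⟩
      dual (dual F)   ≡⟨ cong dual e ⟩
      dual (dual G)   ≡⟨ involutive G G∈ ⟩
      G               ∎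

    surjective : ∀ G → InF U p₂ p₁ G → Σ TieredGraph λ F → InF U p₁ p₂ F × dual F ≡ G
    surjective G G∈ = dual G , dual-InF U p₂ p₁ G G∈ , involutive G G∈
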